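{- Let $G=(V,E)$ be a finite simple graph which admits a proper $3$-coloring using all $3$ colors. Then the two-level instance $\mathcal{M}(G)=(M_P,M_V)$ admits a generalized $(1,0)$-temporal hierarchical clustering.
   Context: For $G=(V,E)$, $\mathcal{M}(G)$ is the sequence of two metric spaces $M_P=(P,d_P)$ and $M_V=(V,d_V)$, where $P=\{r,g,b\}$ is a three-point set with $d_P(p,p')=2$ for distinct $p,p'\in P$, and $d_V(u,v)=2$ if $\{u,v\}\in E$, $d_V(u,v)=1$ if $\{u,v\}\notin E$ and $u\ne v$, and $d_V(u,u)=0$. A pseudo-ultrametric is a pseudometric $\mu$ with $\mu(x,z)\le\max\{\mu(x,y),\mu(y,z)\}$ for all $x,y,z$. For pseudometrics $d_U,d_W$ on the same finite set $Y$, $L^\infty((Y,d_U),(Y,d_W))=\max_{p,p'\in Y}|d_U(p,p')-d_W(p,p')|$. A correspondence between sets $A,B$ is a relation $\mathcal{C}\subseteq A\times B$ whose projections onto $A$ and onto $B$ are surjective; $\mathrm{corr}(A,B)$ is the set of these. For pseudometrics $\mu_1$ on $A$ and $\mu_2$ on $B$, the distortion is $\mathrm{dis}(\mu_1,\mu_2;\mathcal{C})=\max_{(u,v),(u',v')\in\mathcal{C}}|\mu_1(u,u')-\mu_2(v,v')|$. For a sequence of metric spaces $M_i=(P_i,\cdot)$, $i\in[t]$, and $\chi,\rho\ge0$, a generalized $(\chi,\rho)$-temporal hierarchical clustering is a sequence of pseudo-ultrametric spaces $U_i=(P_i,\mu_i)$ with $L^\infty(M_i,U_i)\le\chi$ for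 all $i\in[t]$, together with correspondences $\mathcal{C}_i\in\mathrm{corr}(P_i,P_{i+1})$ with $\mathrm{dis}(\mu_i,\mu_{i+1};\mathcal{C}_i)\le\rho$ for all $i\in[t-1]$. -}

module Defs where

open import Data.Nat using (ℕ; suc)
open import Data.Fin using (Fin; zero; suc; toℕ)
open import Data.Fin.Properties using (_≟_)
open import Data.Bool using (Bool; true; false)
open import Data.Integer using (+_)
open import Data.Rational using (ℚ; _/_; _-_; _⊔_; ∣_∣; _≤_; 0ℚ)
open import Data.Product using (Σ; ∃; _×_; _,_)
open import Relation.Binary.PropositionalEquality using (_≡_)
open import Relation.Nullary using (¬_; yes; no)

record SimpleGraph (n : ℕ) : Set where
  field
    adj    : Fin n → Fin n → Bool
    symm   : ∀ u v → adj u v ≡ adj v u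
    irrefl : ∀ u → adj u u ≡ false
open SimpleGraph public

ProperSurj3Coloring : ∀ {n} → SimpleGraph n → (Fin n → Fin 3) → Set
ProperSurj3Coloring G c =
  (∀ u v → adj G u v ≡ true → ¬ (c u ≡ c v)) × (∀ k → ∃ λ u → c u ≡ k)

record FinSpace : Set where
  constructor finSpace
  field
    size : ℕ
    dist : Fin size → Fin size → ℚ
open FinSpace public

IsPseudometric : ∀ {m} → (Fin m → Fin m → ℚ) → Set
IsPseudometric μ =
  (∀ x → μ x x ≡ 0ℚ) × (∀ x y → 0ℚ ≤ μ x y) × (∀ x y → μ x y ≡ μ y x)
  × (∀ x y z → μ x z ≤ μ x y Data.Rational.+ μ y z)

IsPseudoUltrametric : ∀ {m} → (Fin m → Fin m → ℚ) → Set
IsPseudoUltrametric μ =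
  IsPseudometric μ × (∀ x y z → μ x z ≤ (μ x y ⊔ μ y z))

-- L∞(d, μ) ≤ χ  (max over a finite set ≤ χ, written out pointwise)
L∞≤ : ∀ {m} → (Fin m → Fin m → ℚ) → (Fin m → Fin m → ℚ) → ℚ → Set
L∞≤ d μ χ = ∀ p p' → ∣ d p p' - μ p p' ∣ ≤ χ

IsCorrespondence : ∀ {a b} → (Fin a → Fin b → Set) → Set
IsCorrespondence C = (∀ x → ∃ λ y → C x y) × (∀ y → ∃ λ x → C x y)

-- dis(μ₁, μ₂; C) ≤ ρ  (max over pairs in C, written out pointwise)
Dis≤ : ∀ {a b} → (Fin a → Fin a → ℚ) → (Fin b → Fin b → ℚ)
     → (Fin a → Fin b → Set) → ℚ → Set
Dis≤ μ₁ μ₂ C ρ = ∀ u v u' v' → C u v → C u' v' → ∣ μ₁ u u' - μ₂ v v' ∣ ≤ ρ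

GenTemporalHC : (t : ℕ) → (Fin t → FinSpace) → ℚ → ℚ → Set₁
GenTemporalHC t M χ ρ =
  Σ ((i : Fin t) → Fin (size (M i)) → Fin (size (M i)) → ℚ) λ μ →
    ((i : Fin t) → IsPseudoUltrametric (μ i) × L∞≤ (dist (M i)) (μ i) χ)
  × Σ ((i j : Fin t) → toℕ j ≡ suc (toℕ i) → Fin (size (M i)) → Fin (size (M j)) → Set) λ C →
      ((i j : Fin t) (e : toℕ j ≡ suc (toℕ i)) →
         IsCorrespondence (C i j e) × Dis≤ (μ i) (μ j) (C i j e) ρ)

two one : ℚ
two = + 2 / 1
one = + 1 / 1

d-P : Fin 3 → Fin 3 → ℚ
d-P p p' with p ≟ p'
... | yes _ = 0ℚ
... | no  _ = two

d-V : ∀ {n} → SimpleGraph n → Fin n → Fin n → ℚ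
d-V G u v with u ≟ v
... | yes _ = 0ℚ
... | no  _ with adj G u v
...   | true  = two
...   | false = one

ℳ : ∀ {n} → SimpleGraph n → Fin 2 → FinSpace
ℳ G zero       = finSpace 3 d-P
ℳ {n} G (suc _) = finSpace n (d-V G)

module Submission where

open import Defs
open import Data.Nat using (ℕ)
import Data.Nat as ℕ
open import Data.Fin using (Fin; zero; suc; toℕ)
open import Data.Fin.Properties using (_≟_; all?)
open import Data.Product using (∃; _×_; _,_)
open import Data.Rational using (ℚ; 0ℚ; 1ℚ; _≤_; _≤?_; _⊔_; _+_; _-_; ∣_∣)
open import Data.Rational.Properties using (+-inverseʳ; ≤-refl; ≤-reflexive; ≤-trans; nonNegative⁻¹)
import Data.Rational.Properties as ℚ
open import Data.Bool using (true; false)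
open import Function.Base using (_on_)
open import Relation.Binary.PropositionalEquality using (_≡_; refl; cong)
open import Relation.Nullary using (¬_; yes; no)
open import Relation.Nullary.Decidable using (from-yes)
open import Data.Empty using (⊥-elim)

-- Colour the vertices by a proper surjective 3-colouring c and let both levels
-- carry the discrete metric 2·[p ≠ p'] on colours, pulled back along c on V.
-- Edges join distinct colours, so μ_V = 2 = d_V there; elsewhere d_V ∈ {0, 1}
-- and μ_V ∈ {0, 2} differ by at most 1.  Relating each colour to its colour
-- class is a correspondence (c is onto) of distortion 0 by construction.

d-P-refl : ∀ x → d-P x x ≡ 0ℚ
d-P-refl = from-yes (all? λ x → d-P x x ℚ.≟ 0ℚ)

d-P-isPseudoUltrametric : IsPseudoUltrametric d-P
d-P-isPseudoUltrametric =
  ( d-P-refl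
  , from-yes (all? λ x → all? λ y → 0ℚ ≤? d-P x y)
  , from-yes (all? λ x → all? λ y → d-P x y ℚ.≟ d-P y x)
  , from-yes (all? λ x → all? λ y → all? λ z → d-P x z ≤? (d-P x y + d-P y z)) )
  , from-yes (all? λ x → all? λ y → all? λ z → d-P x z ≤? (d-P x y ⊔ d-P y z))

d-P-≢ : ∀ {x y} → ¬ x ≡ y → d-P x y ≡ two
d-P-≢ {x} {y} x≢y with x ≟ y
... | yes x≡y = ⊥-elim (x≢y x≡y)
... | no  _   = refl

∣one-d-P∣≤1 : ∀ x y → ∣ one - d-P x y ∣ ≤ 1ℚ
∣one-d-P∣≤1 = from-yes (all? λ x → all? λ y → ∣ one - d-P x y ∣ ≤? 1ℚ)

on-isPseudoUltrametric : ∀ {m k} {μ : Fin m → Fin m → ℚ} → IsPseudoUltrametric μ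
                       → (f : Fin k → Fin m) → IsPseudoUltrametric (μ on f)
on-isPseudoUltrametric ((μ-refl , μ-nonneg , μ-sym , μ-tri) , μ-ultra) f =
  ( (λ x → μ-refl (f x))
  , (λ x y → μ-nonneg (f x) (f y))
  , (λ x y → μ-sym (f x) (f y))
  , (λ x y z → μ-tri (f x) (f y) (f z)) )
  , (λ x y z → μ-ultra (f x) (f y) (f z))

∣p-p∣≤ : ∀ {χ} → 0ℚ ≤ χ → ∀ p → ∣ p - p ∣ ≤ χ
∣p-p∣≤ 0≤χ p = ≤-trans (≤-reflexive (cong ∣_∣ (+-inverseʳ p))) 0≤χ

L∞≤-refl : ∀ {m χ} (μ : Fin m → Fin m → ℚ) → 0ℚ ≤ χ → L∞≤ μ μ χ
L∞≤-refl μ 0≤χ p p' = ∣p-p∣≤ 0≤χ (μ p p')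

L∞≤-d-V-on-proper-coloring : ∀ {n} (G : SimpleGraph n) {c : Fin n → Fin 3}
                           → (∀ u v → adj G u v ≡ true → ¬ c u ≡ c v)
                           → L∞≤ (d-V G) (d-P on c) 1ℚ
L∞≤-d-V-on-proper-coloring G {c} proper u v with u ≟ v
... | yes refl rewrite d-P-refl (c u) = ∣p-p∣≤ (nonNegative⁻¹ 1ℚ) 0ℚ
... | no _ with adj G u v in uv∈E
...   | true  = ≤-trans (≤-reflexive (cong (λ d → ∣ two - d ∣) (d-P-≢ (proper u v uv∈E))))
                        (from-yes (∣ two - two ∣ ≤? 1ℚ))
...   | false = ∣one-d-P∣≤1 (c u) (c v)

module _ {m k} (f : Fin k → Fin m) where

  Graph : Fin m → Fin k → Set
  Graph p u = f u ≡ p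

  Graph-isCorrespondence : (∀ p → ∃ λ u → f u ≡ p) → IsCorrespondence Graph
  Graph-isCorrespondence onto = onto , λ u → f u , refl

  Graph-Dis≤0 : (μ : Fin m → Fin m → ℚ) → Dis≤ μ (μ on f) Graph 0ℚ
  Graph-Dis≤0 μ p u p' u' refl refl = ∣p-p∣≤ ≤-refl (μ (f u) (f u'))

lemma9 : (n : ℕ) (G : SimpleGraph n)
       → (∃ λ (c : Fin n → Fin 3) → ProperSurj3Coloring G c)
       → GenTemporalHC 2 (ℳ G) 1ℚ 0ℚ
lemma9 n G (c , proper , onto) = μ , μ-valid , C , C-valid
  where
  μ : (i : Fin 2) → Fin (size (ℳ G i)) → Fin (size (ℳ G i)) → ℚ
  μ zero       = d-P
  μ (suc zero) = d-P on c

  μ-valid : (i : Fin 2) → IsPseudoUltrametric (μ i) × L∞≤ (dist (ℳ G i)) (μ i) 1ℚ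
  μ-valid zero       = d-P-isPseudoUltrametric , L∞≤-refl d-P (nonNegative⁻¹ 1ℚ)
  μ-valid (suc zero) = on-isPseudoUltrametric d-P-isPseudoUltrametric c
                     , L∞≤-d-V-on-proper-coloring G proper

  C : (i j : Fin 2) → toℕ j ≡ ℕ.suc (toℕ i) → Fin (size (ℳ G i)) → Fin (size (ℳ G j)) → Set
  C zero       (suc zero) _  = Graph c
  C zero       zero       ()
  C (suc zero) zero       ()
  C (suc zero) (suc zero) ()

  C-valid : (i j : Fin 2) (e : toℕ j ≡ ℕ.suc (toℕ i))
          → IsCorrespondence (C i j e) × Dis≤ (μ i) (μ j) (C i j e) 0ℚ
  C-valid zero       (suc zero) refl = Graph-isCorrespondence c onto , Graph-Dis≤0 c d-P
  C-valid zero       zero       ()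
  C-valid (suc zero) zero       ()
  C-valid (suc zero) (suc zero) ()
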